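{- Let $r\ge 0$ and $s\ge 1$, let $\mathbf{u}=(u_1,\dots,u_r)$ be an $r$-tuple of positive integers, and let $\mathbf{w}=(w_1,\dots,w_s)$ and $\boldsymbol{\ell}=(\ell_1,\dots,\ell_s)$ be $s$-tuples of positive integers with $2\le \ell_i\le w_i$ for all $i$. Define an equivalence relation $\sim$ on $\{1,\dots,s\}$ by $i\sim j$ if and only if $w_i=w_j$ and $\ell_i=\ell_j$, and let $R\subseteq\{1,\dots,s\}$ be a set of equivalence class representatives. Then \[ C(\mathrm{cat}(\mathbf{u},\mathbf{w}),\mathrm{cat}(1^r,\boldsymbol{\ell}),2) = C(\mathrm{cat}(\mathbf{u},\mathbf{w}^R),\mathrm{cat}(1^r,\boldsymbol{\ell}^R),2). \]
   Context: $1^r$ denotes the $r$-tuple with all entries $1$. For tuples $\mathbf{a}=(a_1,\dots,a_p)$, $\mathbf{b}=(b_1,\dots,b_q)$, $\mathrm{cat}(\mathbf{a},\mathbf{b})=(a_1,\dots,a_p,b_1,\dots,b_q)$. For a tuple $\mathbf{x}$ and a set $I$ of positions, the restriction $\mathbf{x}^I$ is the tuple of entries of $\mathbf{x}$ in the positions in $I$ (in increasing order of position). Generalized covering designs: for $m$-tuples of positive integers $\mathbf{v}=(v_1,\dots,v_m)$, $\mathbf{k}=(k_1,\dots,k_m)$ with $k_i\le v_i$ and an integer $t$ with $1\le t\le \sum_i k_i$, let $X_1,\dots,X_m$ be pairwise disjoint sets with $|X_i|=v_i$. A block is an $m$-tuple $(B_1,\dots,B_m)$ with $B_i\subseteq X_i$,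 $|B_i|=k_i$. An $m$-tuple of sets $(T_1,\dots,T_m)$ is $(\mathbf{v},\mathbf{k},t)$-admissible if $T_i\subseteq X_i$, $|T_i|\le k_i$ and $\sum_i|T_i|=t$; it is contained in a block if $T_i\subseteq B_i$ for all $i$. A ${\rm GC}(\mathbf{v},\mathbf{k},t)$ is a family of blocks (repetitions allowed) such that every admissible tuple is contained in at least one block, and $C(\mathbf{v},\mathbf{k},t)$ is the minimum number of blocks of a ${\rm GC}(\mathbf{v},\mathbf{k},t)$ (taken to be $0$ if no design exists or there are no admissible tuples). -}

module Defs where

open import Data.Nat using (ℕ; zero; suc; _≤_)
open import Data.Bool using (Bool; true; false)
open import Data.Fin using (Fin)
open import Data.Fin.Subset using (Subset; ∣_∣; _⊆_; _∈_)
open import Data.Vec using (Vec; []; _∷_; lookup)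
open import Data.List using (List; length; map; allFin)
open import Data.Nat.ListAction using (sum)
open import Data.List.Relation.Unary.Any using (Any)
open import Data.Product using (Σ; _×_; ∃)
open import Data.Sum using (_⊎_)
open import Relation.Binary.PropositionalEquality using (_≡_)
open import Relation.Nullary using (¬_)

ones : (r : ℕ) → Vec ℕ r
ones zero = []
ones (suc r) = 1 ∷ ones r

restrict : ∀ {A : Set} {n} → Vec A n → (I : Subset n) → Vec A ∣ I ∣
restrict [] [] = []
restrict (x ∷ xs) (true ∷ I) = x ∷ restrict xs I
restrict (x ∷ xs) (false ∷ I) = restrict xs I

-- Generalized covering designs; the point sets are X_i = Fin (v_i)
module _ {m : ℕ} (v k : Vec ℕ m) where

  record Block : Set where
    constructor block
    field
      sets  : (i : Fin m) → Subset (lookup v i)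
      sizes : (i : Fin m) → ∣ sets i ∣ ≡ lookup k i
  open Block public

  SetTuple : Set
  SetTuple = (i : Fin m) → Subset (lookup v i)

  Admissible : ℕ → SetTuple → Set
  Admissible t T = ((i : Fin m) → ∣ T i ∣ ≤ lookup k i)
                 × sum (map (λ i → ∣ T i ∣) (allFin m)) ≡ t

  ContainedIn : SetTuple → Block → Set
  ContainedIn T B = (i : Fin m) → T i ⊆ sets B i

  -- a GC(v,k,t): a family (list, repetitions allowed) of blocks covering
  -- every admissible tuple
  IsGC : ℕ → List Block → Set
  IsGC t D = (T : SetTuple) → Admissible t T → Any (ContainedIn T) D

  -- C(v,k,t) = n : minimum size of a GC(v,k,t), or 0 if no design exists
  -- or there are no admissible tuples
  IsC : ℕ → ℕ → Set
  IsC t n =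
      (Σ (List Block) (λ D → IsGC t D × length D ≡ n)
        × ((D : List Block) → IsGC t D → n ≤ length D))
    ⊎ ((¬ Σ (List Block) (λ D → IsGC t D)) × n ≡ 0)
    ⊎ ((¬ Σ SetTuple (λ T → Admissible t T)) × n ≡ 0)

Equiv : ∀ {s} → Vec ℕ s → Vec ℕ s → Fin s → Fin s → Set
Equiv w ℓ i j = (lookup w i ≡ lookup w j) × (lookup ℓ i ≡ lookup ℓ j)

IsRepresentatives : ∀ {s} → Vec ℕ s → Vec ℕ s → Subset s → Set
IsRepresentatives w ℓ R =
    ((i : Fin _) → Σ (Fin _) (λ j → j ∈ R × Equiv w ℓ i j))
  × ((j j′ : Fin _) → j ∈ R → j′ ∈ R → Equiv w ℓ j j′ → j ≡ j′)

-- For t = 2 and all k_i ≥ 1, a family of blocks is a GC exactly when it covers every pair of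
-- points that fits into one block: two points of different coordinates, or two points of one
-- coordinate X_i with k_i ≥ 2. Collapse every ∼-class of coordinates onto its representative by
-- a map π with a section ι. A design for the collapsed system pulls back along π, since points
-- of merged coordinates fall into one coordinate with ℓ_i ≥ 2, where they can share a block; a
-- design for the original system pushes forward along ι. Both transfers keep the number of
-- blocks, so the minima agree. As some ℓ_i ≥ 2, both systems have admissible tuples, so the
-- value 0 reserved for "no admissible tuple" never occurs.

module Submission where

open import Defs
open import Data.Empty using (⊥-elim)
open import Data.Fin using (Fin; zero; suc; punchIn; fromℕ<; lift; _↑ʳ_)
import Data.Fin.Properties as Fin
open import Data.Fin.Properties using (punchInᵢ≢i)
open import Data.Fin.Subset using (Subset; ∣_∣; _⊆_; _∈_; _∉_; ⊥; ⁅_⁆; _∪_; inside; outside)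
open import Data.Fin.Subset.Properties
  using (∣⊥∣≡0; ⊆-min; x∈⁅x⁆; x∈⁅y⁆⇒x≡y; ∣⁅x⁆∣≡1; ∪-identityˡ; ∪-identityʳ; x∈p∪q⁺; x∈p∪q⁻)
open import Data.List using (List; map; allFin; tabulate)
open import Data.List.Properties using (length-map; map-tabulate)
open import Data.List.Relation.Unary.Any using (Any)
import Data.List.Relation.Unary.Any as Any
open import Data.List.Relation.Unary.Any.Properties using (map⁺)
open import Data.Nat using (ℕ; zero; suc; _≤_; _+_; z≤n; s≤s)
open import Data.Nat.ListAction using (sum)
import Data.Nat.Properties as ℕ
open import Data.Product using (∃; ∃₂; _×_; _,_; proj₁; proj₂)
import Data.Product as Product
open import Data.Sum using (inj₁; inj₂)
open import Data.Vec using (Vec; []; _∷_; _++_; lookup; here; there)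
open import Data.Vec.Properties using (lookup-++ʳ)
open import Data.Vec.Relation.Binary.Pointwise.Extensional using (ext; extensional⇒inductive)
import Data.Vec.Relation.Binary.Pointwise.Inductive as Pointwise
import Data.Vec.Relation.Unary.All.Properties as All
open import Function using (id; _∘′_)
open import Function.Bundles using (_⇔_; mk⇔)
open import Relation.Binary.Definitions using (DecidableEquality)
open import Relation.Binary.PropositionalEquality
open import Relation.Nullary using (yes; no)
import Relation.Nullary.Decidable as Dec

∣p∣≡0⇒p⊆q : ∀ {n} (p : Subset n) {q : Subset n} → ∣ p ∣ ≡ 0 → p ⊆ q
∣p∣≡0⇒p⊆q p e x∈p = ⊥-elim (∣p∣≡0⇒x∉p p e x∈p)
  where
  ∣p∣≡0⇒x∉p : ∀ {n} (p : Subset n) {x} → ∣ p ∣ ≡ 0 → x ∉ p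
  ∣p∣≡0⇒x∉p (outside ∷ p) e (there x∈p) = ∣p∣≡0⇒x∉p p e x∈p

∣p∣≡1⇒p⊆⁅x⁆ : ∀ {n} (p : Subset n) → ∣ p ∣ ≡ 1 → ∃ λ x → p ⊆ ⁅ x ⁆
∣p∣≡1⇒p⊆⁅x⁆ (inside ∷ p) e =
  zero , λ { here → here ; (there y∈p) → there (∣p∣≡0⇒p⊆q p (ℕ.suc-injective e) y∈p) }
∣p∣≡1⇒p⊆⁅x⁆ (outside ∷ p) e with x , p⊆⁅x⁆ ← ∣p∣≡1⇒p⊆⁅x⁆ p e =
  suc x , λ { (there y∈p) → there (p⊆⁅x⁆ y∈p) }

∣p∣≡2⇒p⊆⁅x⁆∪⁅y⁆ : ∀ {n} (p : Subset n) → ∣ p ∣ ≡ 2 → ∃₂ λ x y → p ⊆ ⁅ x ⁆ ∪ ⁅ y ⁆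
∣p∣≡2⇒p⊆⁅x⁆∪⁅y⁆ (inside ∷ p) e with y , p⊆⁅y⁆ ← ∣p∣≡1⇒p⊆⁅x⁆ p (ℕ.suc-injective e) =
  zero , suc y , λ { here → here ; (there z∈p) → there (x∈p∪q⁺ (inj₂ (p⊆⁅y⁆ z∈p))) }
∣p∣≡2⇒p⊆⁅x⁆∪⁅y⁆ (outside ∷ p) e with x , y , p⊆⁅x⁆∪⁅y⁆ ← ∣p∣≡2⇒p⊆⁅x⁆∪⁅y⁆ p e =
  suc x , suc y , λ { (there z∈p) → there (p⊆⁅x⁆∪⁅y⁆ z∈p) }

∣⁅x⁆∪⁅y⁆∣≡2 : ∀ {n} {x y : Fin n} → x ≢ y → ∣ ⁅ x ⁆ ∪ ⁅ y ⁆ ∣ ≡ 2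
∣⁅x⁆∪⁅y⁆∣≡2 {x = zero}  {zero}  x≢y = ⊥-elim (x≢y refl)
∣⁅x⁆∪⁅y⁆∣≡2 {x = zero}  {suc y} _   rewrite ∪-identityˡ ⁅ y ⁆ = cong suc (∣⁅x⁆∣≡1 y)
∣⁅x⁆∪⁅y⁆∣≡2 {x = suc x} {zero}  _   rewrite ∪-identityʳ ⁅ x ⁆ = cong suc (∣⁅x⁆∣≡1 x)
∣⁅x⁆∪⁅y⁆∣≡2 {x = suc x} {suc y} x≢y = ∣⁅x⁆∪⁅y⁆∣≡2 (x≢y ∘′ cong suc)

x∈p⇒⁅x⁆⊆p : ∀ {n} {x : Fin n} {p} → x ∈ p → ⁅ x ⁆ ⊆ p
x∈p⇒⁅x⁆⊆p {x = x} x∈p z∈⁅x⁆ = subst (_∈ _) (sym (x∈⁅y⁆⇒x≡y x z∈⁅x⁆)) x∈p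

x,y∈p⇒⁅x⁆∪⁅y⁆⊆p : ∀ {n} {x y : Fin n} {p} → x ∈ p → y ∈ p → ⁅ x ⁆ ∪ ⁅ y ⁆ ⊆ p
x,y∈p⇒⁅x⁆∪⁅y⁆⊆p x∈p y∈p z∈ with x∈p∪q⁻ _ _ z∈
... | inj₁ z∈⁅x⁆ = x∈p⇒⁅x⁆⊆p x∈p z∈⁅x⁆
... | inj₂ z∈⁅y⁆ = x∈p⇒⁅x⁆⊆p y∈p z∈⁅y⁆

-- Records rather than bare Π and Σ types, so that v is inferable; at T is a SetTuple v k.
record Tuple {m} (v : Vec ℕ m) : Set where
  constructor tuple
  field
    at : (i : Fin m) → Subset (lookup v i)
open Tuple public

record Point {m} (v : Vec ℕ m) : Set where
  constructor _,_
  field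
    coord : Fin m
    elem  : Fin (lookup v coord)
open Point public

module _ {m : ℕ} {v : Vec ℕ m} where

  infix 4 _∈ᵗ_ _⊆ᵗ_

  _∈ᵗ_ : Point v → Tuple v → Set
  p ∈ᵗ T = elem p ∈ at T (coord p)

  _⊆ᵗ_ : Tuple v → Tuple v → Set
  T ⊆ᵗ B = ∀ i → at T i ⊆ at B i

  ⊆ᵗ-trans : ∀ {T B C} → T ⊆ᵗ B → B ⊆ᵗ C → T ⊆ᵗ C
  ⊆ᵗ-trans T⊆B B⊆C i x∈T = B⊆C i (T⊆B i x∈T)

  size : Tuple v → ℕ
  size T = sum (tabulate λ i → ∣ at T i ∣)

  ∅ᵗ : Tuple v
  ∅ᵗ = tuple λ _ → ⊥

module _ {m a : ℕ} {v : Vec ℕ m} where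

  infixr 5 _∷ᵗ_

  _∷ᵗ_ : Subset a → Tuple v → Tuple (a ∷ v)
  at (S ∷ᵗ T) zero    = S
  at (S ∷ᵗ T) (suc i) = at T i

  tailᵗ : Tuple (a ∷ v) → Tuple v
  at (tailᵗ T) i = at T (suc i)

  sucᵖ : Point v → Point (a ∷ v)
  sucᵖ (i , x) = suc i , x

zero,-injective : ∀ {m a} {v : Vec ℕ m} {x y : Fin a} →
                  _≡_ {A = Point (a ∷ v)} (zero , x) (zero , y) → x ≡ y
zero,-injective refl = refl

sucᵖ-injective : ∀ {m a} {v : Vec ℕ m} {p q : Point v} → sucᵖ {a = a} p ≡ sucᵖ q → p ≡ q
sucᵖ-injective refl = refl

_≟ᵖ_ : ∀ {m} {v : Vec ℕ m} → DecidableEquality (Point v)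
_≟ᵖ_ {v = _ ∷ _} (zero  , x) (zero  , y) = Dec.map′ (cong (zero ,_)) zero,-injective (x Fin.≟ y)
_≟ᵖ_ {v = _ ∷ _} (zero  , _) (suc _ , _) = no λ ()
_≟ᵖ_ {v = _ ∷ _} (suc _ , _) (zero  , _) = no λ ()
_≟ᵖ_ {v = _ ∷ v} (suc i , x) (suc j , y) =
  Dec.map′ (cong sucᵖ) sucᵖ-injective (_≟ᵖ_ {v = v} (i , x) (j , y))

∃-distinct-same-coord : ∀ {m} {v : Vec ℕ m} (p : Point v) → 2 ≤ lookup v (coord p) →
                        ∃ λ q → coord p ≡ coord q × p ≢ q
∃-distinct-same-coord {v = _ ∷ _} (zero  , x) (s≤s (s≤s _)) =
  (zero , punchIn x zero) , refl , λ eq → punchInᵢ≢i x zero (sym (zero,-injective eq))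
∃-distinct-same-coord {v = _ ∷ v} (suc i , x) 2≤v
  with q , same , p≢q ← ∃-distinct-same-coord {v = v} (i , x) 2≤v =
  sucᵖ q , cong suc same , p≢q ∘′ sucᵖ-injective

pointᵗ : ∀ {m} {v : Vec ℕ m} → Point v → Tuple v
pointᵗ {v = _ ∷ _} (zero  , x) = ⁅ x ⁆ ∷ᵗ ∅ᵗ
pointᵗ {v = _ ∷ _} (suc i , x) = ⊥ ∷ᵗ pointᵗ (i , x)

pairᵗ : ∀ {m} {v : Vec ℕ m} → Point v → Point v → Tuple v
pairᵗ {v = _ ∷ _} (zero  , x) (zero  , y) = (⁅ x ⁆ ∪ ⁅ y ⁆) ∷ᵗ ∅ᵗ
pairᵗ {v = _ ∷ _} (zero  , x) (suc j , y) = ⁅ x ⁆ ∷ᵗ pointᵗ (j , y)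
pairᵗ {v = _ ∷ _} (suc i , x) (zero  , y) = ⁅ y ⁆ ∷ᵗ pointᵗ (i , x)
pairᵗ {v = _ ∷ _} (suc i , x) (suc j , y) = ⊥ ∷ᵗ pairᵗ (i , x) (j , y)

size-∅ᵗ : ∀ {m} {v : Vec ℕ m} → size (∅ᵗ {v = v}) ≡ 0
size-∅ᵗ {v = []}    = refl
size-∅ᵗ {v = a ∷ v} = cong₂ _+_ (∣⊥∣≡0 a) (size-∅ᵗ {v = v})

size-pointᵗ : ∀ {m} {v : Vec ℕ m} (p : Point v) → size (pointᵗ p) ≡ 1
size-pointᵗ {v = a ∷ v} (zero  , x) = cong₂ _+_ (∣⁅x⁆∣≡1 x) (size-∅ᵗ {v = v})
size-pointᵗ {v = a ∷ v} (suc i , x) = cong₂ _+_ (∣⊥∣≡0 a) (size-pointᵗ {v = v} (i , x))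

size-pairᵗ : ∀ {m} {v : Vec ℕ m} {p q : Point v} → p ≢ q → size (pairᵗ p q) ≡ 2
size-pairᵗ {v = a ∷ v} {zero  , x} {zero  , y} p≢q =
  cong₂ _+_ (∣⁅x⁆∪⁅y⁆∣≡2 (p≢q ∘′ cong (zero ,_))) (size-∅ᵗ {v = v})
size-pairᵗ {v = a ∷ v} {zero  , x} {suc j , y} _ = cong₂ _+_ (∣⁅x⁆∣≡1 x) (size-pointᵗ {v = v} (j , y))
size-pairᵗ {v = a ∷ v} {suc i , x} {zero  , y} _ = cong₂ _+_ (∣⁅x⁆∣≡1 y) (size-pointᵗ {v = v} (i , x))
size-pairᵗ {v = a ∷ v} {suc i , x} {suc j , y} p≢q =
  cong₂ _+_ (∣⊥∣≡0 a) (size-pairᵗ {v = v} (p≢q ∘′ cong sucᵖ))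

⊆ᵗ-∷ : ∀ {m a} {v : Vec ℕ m} {T B : Tuple (a ∷ v)} →
       at T zero ⊆ at B zero → tailᵗ T ⊆ᵗ tailᵗ B → T ⊆ᵗ B
⊆ᵗ-∷ T₀⊆B₀ T⊆B zero    = T₀⊆B₀
⊆ᵗ-∷ T₀⊆B₀ T⊆B (suc i) = T⊆B i

pointᵗ-⊆ᵗ : ∀ {m} {v : Vec ℕ m} (p : Point v) {B : Tuple v} → p ∈ᵗ B → pointᵗ p ⊆ᵗ B
pointᵗ-⊆ᵗ {v = _ ∷ v} (zero  , x) x∈B = ⊆ᵗ-∷ (x∈p⇒⁅x⁆⊆p x∈B) (λ _ → ⊆-min _)
pointᵗ-⊆ᵗ {v = _ ∷ v} (suc i , x) x∈B = ⊆ᵗ-∷ (⊆-min _) (pointᵗ-⊆ᵗ {v = v} (i , x) x∈B)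

pairᵗ-⊆ᵗ : ∀ {m} {v : Vec ℕ m} (p q : Point v) {B : Tuple v} → p ∈ᵗ B → q ∈ᵗ B → pairᵗ p q ⊆ᵗ B
pairᵗ-⊆ᵗ {v = _ ∷ v} (zero  , x) (zero  , y) x∈B y∈B = ⊆ᵗ-∷ (x,y∈p⇒⁅x⁆∪⁅y⁆⊆p x∈B y∈B) (λ _ → ⊆-min _)
pairᵗ-⊆ᵗ {v = _ ∷ v} (zero  , x) (suc j , y) x∈B y∈B = ⊆ᵗ-∷ (x∈p⇒⁅x⁆⊆p x∈B) (pointᵗ-⊆ᵗ {v = v} (j , y) y∈B)
pairᵗ-⊆ᵗ {v = _ ∷ v} (suc i , x) (zero  , y) x∈B y∈B = ⊆ᵗ-∷ (x∈p⇒⁅x⁆⊆p y∈B) (pointᵗ-⊆ᵗ {v = v} (i , x) x∈B)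
pairᵗ-⊆ᵗ {v = _ ∷ v} (suc i , x) (suc j , y) x∈B y∈B =
  ⊆ᵗ-∷ (⊆-min _) (pairᵗ-⊆ᵗ {v = v} (i , x) (j , y) x∈B y∈B)

p∈pointᵗp : ∀ {m} {v : Vec ℕ m} (p : Point v) → p ∈ᵗ pointᵗ p
p∈pointᵗp {v = _ ∷ v} (zero  , x) = x∈⁅x⁆ x
p∈pointᵗp {v = _ ∷ v} (suc i , x) = p∈pointᵗp {v = v} (i , x)

p∈pairᵗpq : ∀ {m} {v : Vec ℕ m} (p q : Point v) → p ∈ᵗ pairᵗ p q
p∈pairᵗpq {v = _ ∷ v} (zero  , x) (zero  , y) = x∈p∪q⁺ (inj₁ (x∈⁅x⁆ x))
p∈pairᵗpq {v = _ ∷ v} (zero  , x) (suc j , y) = x∈⁅x⁆ x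
p∈pairᵗpq {v = _ ∷ v} (suc i , x) (zero  , y) = p∈pointᵗp {v = v} (i , x)
p∈pairᵗpq {v = _ ∷ v} (suc i , x) (suc j , y) = p∈pairᵗpq {v = v} (i , x) (j , y)

q∈pairᵗpq : ∀ {m} {v : Vec ℕ m} (p q : Point v) → q ∈ᵗ pairᵗ p q
q∈pairᵗpq {v = _ ∷ v} (zero  , x) (zero  , y) = x∈p∪q⁺ (inj₂ (x∈⁅x⁆ y))
q∈pairᵗpq {v = _ ∷ v} (zero  , x) (suc j , y) = p∈pointᵗp {v = v} (j , y)
q∈pairᵗpq {v = _ ∷ v} (suc i , x) (zero  , y) = x∈⁅x⁆ y
q∈pairᵗpq {v = _ ∷ v} (suc i , x) (suc j , y) = q∈pairᵗpq {v = v} (i , x) (j , y)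

Coverable : ∀ {m} {v : Vec ℕ m} → Vec ℕ m → Point v → Point v → Set
Coverable k p q = coord p ≡ coord q → 2 ≤ lookup k (coord p)

∣⊥∣≤n : ∀ a {n} → ∣ ⊥ {n = a} ∣ ≤ n
∣⊥∣≤n a = subst (_≤ _) (sym (∣⊥∣≡0 a)) z≤n

∣pointᵗ∣≤1 : ∀ {m} {v : Vec ℕ m} (p : Point v) i → ∣ at (pointᵗ p) i ∣ ≤ 1
∣pointᵗ∣≤1 {v = _ ∷ _} (zero  , x) zero    = ℕ.≤-reflexive (∣⁅x⁆∣≡1 x)
∣pointᵗ∣≤1 {v = _ ∷ v} (zero  , x) (suc j) = ∣⊥∣≤n (lookup v j)
∣pointᵗ∣≤1 {v = a ∷ _} (suc i , x) zero    = ∣⊥∣≤n a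
∣pointᵗ∣≤1 {v = _ ∷ v} (suc i , x) (suc j) = ∣pointᵗ∣≤1 {v = v} (i , x) j

∣pairᵗ∣≤k : ∀ {m} {v k : Vec ℕ m} (p q : Point v) → (∀ i → 1 ≤ lookup k i) → p ≢ q → Coverable k p q →
            ∀ i → ∣ at (pairᵗ p q) i ∣ ≤ lookup k i
∣pairᵗ∣≤k {v = _ ∷ _} (zero  , x) (zero  , y) _   p≢q cov zero =
  subst (_≤ _) (sym (∣⁅x⁆∪⁅y⁆∣≡2 (p≢q ∘′ cong (zero ,_)))) (cov refl)
∣pairᵗ∣≤k {v = _ ∷ v} (zero  , x) (zero  , y) _   _   _   (suc j) = ∣⊥∣≤n (lookup v j)
∣pairᵗ∣≤k {v = _ ∷ _} (zero  , x) (suc _ , y) 1≤k _ _ zero    = subst (_≤ _) (sym (∣⁅x⁆∣≡1 x)) (1≤k zero)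
∣pairᵗ∣≤k {v = _ ∷ v} (zero  , x) (suc i , y) 1≤k _ _ (suc j) =
  ℕ.≤-trans (∣pointᵗ∣≤1 {v = v} (i , y) j) (1≤k (suc j))
∣pairᵗ∣≤k {v = _ ∷ _} (suc _ , x) (zero  , y) 1≤k _ _ zero    = subst (_≤ _) (sym (∣⁅x⁆∣≡1 y)) (1≤k zero)
∣pairᵗ∣≤k {v = _ ∷ v} (suc i , x) (zero  , y) 1≤k _ _ (suc j) =
  ℕ.≤-trans (∣pointᵗ∣≤1 {v = v} (i , x) j) (1≤k (suc j))
∣pairᵗ∣≤k {v = a ∷ _} (suc _ , x) (suc _ , y) _   _   _   zero    = ∣⊥∣≤n a
∣pairᵗ∣≤k {v = _ ∷ v} {_ ∷ k} (suc i , x) (suc j , y) 1≤k p≢q cov (suc l) =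
  ∣pairᵗ∣≤k {v = v} {k} (i , x) (j , y) (λ i → 1≤k (suc i)) (p≢q ∘′ cong sucᵖ) (cov ∘′ cong suc) l

size-allFin : ∀ {m} {v : Vec ℕ m} (T : Tuple v) → sum (map (λ i → ∣ at T i ∣) (allFin m)) ≡ size T
size-allFin T = cong sum (map-tabulate id λ i → ∣ at T i ∣)

pairᵗ-admissible : ∀ {m} {v k : Vec ℕ m} (p q : Point v) → (∀ i → 1 ≤ lookup k i) → p ≢ q →
                   Coverable k p q → Admissible v k 2 (at (pairᵗ p q))
pairᵗ-admissible {k = k} p q 1≤k p≢q cov =
  ∣pairᵗ∣≤k {k = k} p q 1≤k p≢q cov , trans (size-allFin (pairᵗ p q)) (size-pairᵗ p≢q)

admissible-exists : ∀ {m} {v k : Vec ℕ m} → (∀ i → 1 ≤ lookup k i) → (∀ i → lookup k i ≤ lookup v i) →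
                    ∀ i → 2 ≤ lookup k i → ∃ (Admissible v k 2)
admissible-exists {v = v} {k} 1≤k k≤v i 2≤kᵢ =
  let q , _ , p≢q = ∃-distinct-same-coord p 2≤vᵢ
  in at (pairᵗ p q) , pairᵗ-admissible {k = k} p q 1≤k p≢q λ _ → 2≤kᵢ
  where
  2≤vᵢ : 2 ≤ lookup v i
  2≤vᵢ = ℕ.≤-trans 2≤kᵢ (k≤v i)
  p : Point v
  p = i , fromℕ< (ℕ.≤-trans (s≤s z≤n) 2≤vᵢ)

size≡0⇒⊆ᵗ : ∀ {m} {v : Vec ℕ m} (T : Tuple v) {B : Tuple v} → size T ≡ 0 → T ⊆ᵗ B
size≡0⇒⊆ᵗ {v = []}    T e ()
size≡0⇒⊆ᵗ {v = _ ∷ v} T e =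
  ⊆ᵗ-∷ (∣p∣≡0⇒p⊆q _ (ℕ.m+n≡0⇒m≡0 _ e)) (size≡0⇒⊆ᵗ {v = v} (tailᵗ T) (ℕ.m+n≡0⇒n≡0 _ e))

size≡1⇒⊆ᵗpointᵗ : ∀ {m} {v : Vec ℕ m} (T : Tuple v) → size T ≡ 1 → ∃ λ p → T ⊆ᵗ pointᵗ p
size≡1⇒⊆ᵗpointᵗ {v = _ ∷ v} T e with ∣ at T zero ∣ in e₀
... | 0 with p , T⊆p ← size≡1⇒⊆ᵗpointᵗ {v = v} (tailᵗ T) e = sucᵖ p , ⊆ᵗ-∷ (∣p∣≡0⇒p⊆q _ e₀) T⊆p
... | 1 with x , T₀⊆x ← ∣p∣≡1⇒p⊆⁅x⁆ _ e₀ =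
  (zero , x) , ⊆ᵗ-∷ T₀⊆x (size≡0⇒⊆ᵗ {v = v} (tailᵗ T) (ℕ.suc-injective e))

size≡2⇒⊆ᵗpairᵗ : ∀ {m} {v k : Vec ℕ m} (T : Tuple v) → (∀ i → ∣ at T i ∣ ≤ lookup k i) → size T ≡ 2 →
                 ∃₂ λ p q → Coverable k p q × T ⊆ᵗ pairᵗ p q
size≡2⇒⊆ᵗpairᵗ {v = _ ∷ v} {_ ∷ k} T T≤k e with ∣ at T zero ∣ in e₀
... | 0 with p , q , cov , T⊆pq ← size≡2⇒⊆ᵗpairᵗ {v = v} {k} (tailᵗ T) (λ i → T≤k (suc i)) e =
  sucᵖ p , sucᵖ q , cov ∘′ Fin.suc-injective , ⊆ᵗ-∷ (∣p∣≡0⇒p⊆q _ e₀) T⊆pq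
... | 1 with x , T₀⊆x ← ∣p∣≡1⇒p⊆⁅x⁆ _ e₀ | q , T⊆q ← size≡1⇒⊆ᵗpointᵗ {v = v} (tailᵗ T) (ℕ.suc-injective e) =
  (zero , x) , sucᵖ q , (λ ()) , ⊆ᵗ-∷ T₀⊆x T⊆q
... | 2 with x , y , T₀⊆xy ← ∣p∣≡2⇒p⊆⁅x⁆∪⁅y⁆ _ e₀ =
  (zero , x) , (zero , y) , (λ _ → subst (_≤ _) e₀ (T≤k zero)) ,
  ⊆ᵗ-∷ T₀⊆xy (size≡0⇒⊆ᵗ {v = v} (tailᵗ T) (ℕ.suc-injective (ℕ.suc-injective e)))

module _ {m : ℕ} {v k : Vec ℕ m} where

  Covers : List (Block v k) → Point v → Point v → Set
  Covers D p q = Any (λ B → p ∈ᵗ tuple (sets B) × q ∈ᵗ tuple (sets B)) D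

  PairCovering : List (Block v k) → Set
  PairCovering D = ∀ p q → Coverable k p q → Covers D p q

  PairCovering⇒IsGC : ∀ {D} → PairCovering D → IsGC v k 2 D
  PairCovering⇒IsGC cover T (T≤k , ΣT≡2)
    with p , q , cov , T⊆pq ← size≡2⇒⊆ᵗpairᵗ {k = k} (tuple T) T≤k
                                 (trans (sym (size-allFin {v = v} (tuple T))) ΣT≡2) =
    Any.map (λ {B} (p∈B , q∈B) → ⊆ᵗ-trans {v = v} T⊆pq (pairᵗ-⊆ᵗ p q {tuple (sets B)} p∈B q∈B))
            (cover p q cov)

  IsGC⇒covers-distinct : ∀ {D} → (∀ i → 1 ≤ lookup k i) → IsGC v k 2 D →
                        ∀ p q → p ≢ q → Coverable k p q → Covers D p q
  IsGC⇒covers-distinct 1≤k gc p q p≢q cov =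
    Any.map (λ pq⊆B → pq⊆B (coord p) (p∈pairᵗpq p q) , pq⊆B (coord q) (q∈pairᵗpq p q))
            (gc (at (pairᵗ p q)) (pairᵗ-admissible {k = k} p q 1≤k p≢q cov))

  IsGC⇒PairCovering : ∀ {D} → (∀ i → 1 ≤ lookup k i) → (∀ i → lookup k i ≤ lookup v i) →
                      IsGC v k 2 D → PairCovering D
  IsGC⇒PairCovering 1≤k k≤v gc p q cov with p ≟ᵖ q
  ... | no p≢q = IsGC⇒covers-distinct 1≤k gc p q p≢q cov
  ... | yes refl with q , _ , p≢q ← ∃-distinct-same-coord p (ℕ.≤-trans (cov refl) (k≤v (coord p))) =
    Any.map (λ (p∈B , _) → p∈B , p∈B) (IsGC⇒covers-distinct 1≤k gc p q p≢q λ _ → cov refl)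

module _ {m m′ t : ℕ} {v k : Vec ℕ m} {v′ k′ : Vec ℕ m′}
         (f : Block v k → Block v′ k′) (g : Block v′ k′ → Block v k)
         (f-IsGC : ∀ {D} → IsGC v k t D → IsGC v′ k′ t (map f D))
         (g-IsGC : ∀ {D} → IsGC v′ k′ t D → IsGC v k t (map g D)) where

  IsC-transfer : ∃ (Admissible v k t) → ∀ {n} → IsC v k t n → IsC v′ k′ t n
  IsC-transfer _ (inj₁ ((D , gc , ∣D∣≡n) , minimal)) =
    inj₁ ( (map f D , f-IsGC gc , trans (length-map f D) ∣D∣≡n)
         , λ D′ gc′ → subst (_ ≤_) (length-map g D′) (minimal (map g D′) (g-IsGC gc′)))
  IsC-transfer _ (inj₂ (inj₁ (noDesign , n≡0))) =
    inj₂ (inj₁ ((λ (D′ , gc′) → noDesign (map g D′ , g-IsGC gc′)) , n≡0))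
  IsC-transfer admissible (inj₂ (inj₂ (noAdmissible , _))) = ⊥-elim (noAdmissible admissible)

∣subst∣ : ∀ {a b} (e : a ≡ b) (S : Subset a) → ∣ subst Subset e S ∣ ≡ ∣ S ∣
∣subst∣ refl S = refl

∈-subst : ∀ {a b} (e : a ≡ b) {x : Fin a} {S : Subset b} → subst Fin e x ∈ S → x ∈ subst Subset (sym e) S
∈-subst refl x∈S = x∈S

module Reindex {m m′ : ℕ} {v k : Vec ℕ m} {v′ k′ : Vec ℕ m′} (σ : Fin m′ → Fin m)
               (v′≡v∘σ : ∀ j → lookup v′ j ≡ lookup v (σ j))
               (k′≡k∘σ : ∀ j → lookup k′ j ≡ lookup k (σ j)) where

  reindexᵖ : Point v′ → Point v
  reindexᵖ (j , y) = σ j , subst Fin (v′≡v∘σ j) y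

  reindex : Block v k → Block v′ k′
  reindex B = block (λ j → subst Subset (sym (v′≡v∘σ j)) (sets B (σ j)))
                    (λ j → trans (∣subst∣ (sym (v′≡v∘σ j)) _) (trans (sizes B (σ j)) (sym (k′≡k∘σ j))))

  covers-reindex : ∀ {D p q} → Covers D (reindexᵖ p) (reindexᵖ q) → Covers (map reindex D) p q
  covers-reindex {p = p} {q} =
    map⁺ ∘′ Any.map (Product.map (∈-subst (v′≡v∘σ (coord p))) (∈-subst (v′≡v∘σ (coord q))))

  PairCovering-reindex : (∀ j j′ → j ≢ j′ → σ j ≡ σ j′ → 2 ≤ lookup k′ j) →
                         ∀ {D} → PairCovering D → PairCovering (map reindex D)
  PairCovering-reindex merged⇒2≤k′ cover p q cov = covers-reindex (cover (reindexᵖ p) (reindexᵖ q) cov′)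
    where
    cov′ : Coverable k (reindexᵖ p) (reindexᵖ q)
    cov′ σp≡σq with coord p Fin.≟ coord q
    ... | yes same  = subst (2 ≤_) (k′≡k∘σ (coord p)) (cov same)
    ... | no differ = subst (2 ≤_) (k′≡k∘σ (coord p)) (merged⇒2≤k′ _ _ differ σp≡σq)

module _ {m m′ : ℕ} {v k : Vec ℕ m} {v′ k′ : Vec ℕ m′}
         (π : Fin m → Fin m′) (ι : Fin m′ → Fin m) (π∘ι : ∀ j → π (ι j) ≡ j)
         (v≡v′∘π : ∀ i → lookup v i ≡ lookup v′ (π i)) (k≡k′∘π : ∀ i → lookup k i ≡ lookup k′ (π i))
         (merged⇒2≤k : ∀ i i′ → i ≢ i′ → π i ≡ π i′ → 2 ≤ lookup k i)
         (1≤k : ∀ i → 1 ≤ lookup k i) (k≤v : ∀ i → lookup k i ≤ lookup v i) where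

  private
    along-ι : ∀ (u : Vec ℕ m) (u′ : Vec ℕ m′) → (∀ i → lookup u i ≡ lookup u′ (π i)) →
              ∀ j → lookup u′ j ≡ lookup u (ι j)
    along-ι u u′ u≡u′∘π j = trans (cong (lookup u′) (sym (π∘ι j))) (sym (u≡u′∘π (ι j)))

    v′≡v∘ι : ∀ j → lookup v′ j ≡ lookup v (ι j)
    v′≡v∘ι = along-ι v v′ v≡v′∘π

    k′≡k∘ι : ∀ j → lookup k′ j ≡ lookup k (ι j)
    k′≡k∘ι = along-ι k k′ k≡k′∘π

    1≤k′ : ∀ j → 1 ≤ lookup k′ j
    1≤k′ j = subst (1 ≤_) (sym (k′≡k∘ι j)) (1≤k (ι j))

    k′≤v′ : ∀ j → lookup k′ j ≤ lookup v′ j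
    k′≤v′ j = subst₂ _≤_ (sym (k′≡k∘ι j)) (sym (v′≡v∘ι j)) (k≤v (ι j))

    ι-merges-nothing : ∀ j j′ → j ≢ j′ → ι j ≡ ι j′ → 2 ≤ lookup k′ j
    ι-merges-nothing j j′ j≢j′ ιj≡ιj′ = ⊥-elim (j≢j′ (trans (sym (π∘ι j)) (trans (cong π ιj≡ιj′) (π∘ι j′))))

    module Pull = Reindex {v = v′} {k′} {v} {k} π v≡v′∘π k≡k′∘π
    module Push = Reindex {v = v} {k} {v′} {k′} ι v′≡v∘ι k′≡k∘ι

    push-IsGC : ∀ {D} → IsGC v k 2 D → IsGC v′ k′ 2 (map Push.reindex D)
    push-IsGC gc =
      PairCovering⇒IsGC (Push.PairCovering-reindex ι-merges-nothing (IsGC⇒PairCovering 1≤k k≤v gc))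

    pull-IsGC : ∀ {D} → IsGC v′ k′ 2 D → IsGC v k 2 (map Pull.reindex D)
    pull-IsGC gc =
      PairCovering⇒IsGC (Pull.PairCovering-reindex merged⇒2≤k (IsGC⇒PairCovering 1≤k′ k′≤v′ gc))

  IsC-collapse : ∀ i → 2 ≤ lookup k i → ∀ n → IsC v k 2 n ⇔ IsC v′ k′ 2 n
  IsC-collapse i 2≤kᵢ n = mk⇔
    (IsC-transfer Push.reindex Pull.reindex push-IsGC pull-IsGC
      (admissible-exists {v = v} {k} 1≤k k≤v i 2≤kᵢ))
    (IsC-transfer Pull.reindex Push.reindex pull-IsGC push-IsGC
      (admissible-exists {v = v′} {k′} 1≤k′ k′≤v′ (π i) (subst (2 ≤_) (k≡k′∘π i) 2≤kᵢ)))

unrank : ∀ {s} (R : Subset s) → Fin ∣ R ∣ → Fin s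
unrank (inside  ∷ R) zero    = zero
unrank (inside  ∷ R) (suc q) = suc (unrank R q)
unrank (outside ∷ R) q       = suc (unrank R q)

unrank∈R : ∀ {s} (R : Subset s) q → unrank R q ∈ R
unrank∈R (inside  ∷ R) zero    = here
unrank∈R (inside  ∷ R) (suc q) = there (unrank∈R R q)
unrank∈R (outside ∷ R) q       = there (unrank∈R R q)

unrank-injective : ∀ {s} (R : Subset s) {q q′} → unrank R q ≡ unrank R q′ → q ≡ q′
unrank-injective (inside  ∷ R) {zero}  {zero}   _  = refl
unrank-injective (inside  ∷ R) {suc q} {suc q′} eq = cong suc (unrank-injective R (Fin.suc-injective eq))
unrank-injective (outside ∷ R)                  eq = unrank-injective R (Fin.suc-injective eq)

rank : ∀ {s} (R : Subset s) {j} → j ∈ R → Fin ∣ R ∣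
rank (inside  ∷ R) here        = zero
rank (inside  ∷ R) (there j∈R) = suc (rank R j∈R)
rank (outside ∷ R) (there j∈R) = rank R j∈R

unrank-rank : ∀ {s} (R : Subset s) {j} (j∈R : j ∈ R) → unrank R (rank R j∈R) ≡ j
unrank-rank (inside  ∷ R) here        = refl
unrank-rank (inside  ∷ R) (there j∈R) = cong suc (unrank-rank R j∈R)
unrank-rank (outside ∷ R) (there j∈R) = cong suc (unrank-rank R j∈R)

lookup-restrict : ∀ {A : Set} {s} (y : Vec A s) (R : Subset s) q →
                  lookup (restrict y R) q ≡ lookup y (unrank R q)
lookup-restrict (_ ∷ y) (inside  ∷ R) zero    = refl
lookup-restrict (_ ∷ y) (inside  ∷ R) (suc q) = lookup-restrict y R q
lookup-restrict (_ ∷ y) (outside ∷ R) q       = lookup-restrict y R q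

module Transversal {s} (R : Subset s) (_∼_ : Fin s → Fin s → Set)
                   (rep-exists : ∀ i → ∃ λ j → j ∈ R × i ∼ j)
                   (rep-unique : ∀ j j′ → j ∈ R → j′ ∈ R → j ∼ j′ → j ≡ j′) where

  repIndex : Fin s → Fin ∣ R ∣
  repIndex i = rank R (proj₁ (proj₂ (rep-exists i)))

  ∼-unrank-repIndex : ∀ i → i ∼ unrank R (repIndex i)
  ∼-unrank-repIndex i with j , j∈R , i∼j ← rep-exists i = subst (i ∼_) (sym (unrank-rank R j∈R)) i∼j

  repIndex-unrank : ∀ q → repIndex (unrank R q) ≡ q
  repIndex-unrank q =
    unrank-injective R (sym (rep-unique _ _ (unrank∈R R q) (unrank∈R R (repIndex _)) (∼-unrank-repIndex _)))

lookup-ones : ∀ r (i : Fin r) → lookup (ones r) i ≡ 1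
lookup-ones (suc r) zero    = refl
lookup-ones (suc r) (suc i) = lookup-ones r i

lift-inverse : ∀ r {s s′} {f : Fin s → Fin s′} {g : Fin s′ → Fin s} → (∀ j → f (g j) ≡ j) →
               ∀ i → lift r f (lift r g i) ≡ i
lift-inverse zero    f∘g≡id i       = f∘g≡id i
lift-inverse (suc r) f∘g≡id zero    = refl
lift-inverse (suc r) f∘g≡id (suc i) = cong suc (lift-inverse r f∘g≡id i)

lift-merged⇒↑ʳ : ∀ r {s s′} (f : Fin s → Fin s′) {i i′ : Fin (r + s)} → i ≢ i′ → lift r f i ≡ lift r f i′ →
                 ∃ λ j → i ≡ r ↑ʳ j
lift-merged⇒↑ʳ zero    f {i}                 _     _  = i , refl
lift-merged⇒↑ʳ (suc r) f {zero}  {zero}      i≢i′  _  = ⊥-elim (i≢i′ refl)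
lift-merged⇒↑ʳ (suc r) f {suc i} {suc i′}    i≢i′  eq
  with j , i≡r↑ʳj ← lift-merged⇒↑ʳ r f (i≢i′ ∘′ cong suc) (Fin.suc-injective eq) = j , cong suc i≡r↑ʳj

lookup-++-lift : ∀ {A : Set} {r s s′} (x : Vec A r) {y : Vec A s} {y′ : Vec A s′} {f : Fin s → Fin s′} →
                 (∀ j → lookup y j ≡ lookup y′ (f j)) →
                 ∀ i → lookup (x ++ y) i ≡ lookup (x ++ y′) (lift r f i)
lookup-++-lift []      y≡y′∘f i       = y≡y′∘f i
lookup-++-lift (a ∷ x) y≡y′∘f zero    = refl
lookup-++-lift (a ∷ x) y≡y′∘f (suc i) = lookup-++-lift x y≡y′∘f i

lookup-++-pointwise : ∀ {A B : Set} (_∼_ : A → B → Set) {r s}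
                      (x : Vec A r) (x′ : Vec B r) (y : Vec A s) (y′ : Vec B s) →
                      (∀ i → lookup x i ∼ lookup x′ i) → (∀ j → lookup y j ∼ lookup y′ j) →
                      ∀ i → lookup (x ++ y) i ∼ lookup (x′ ++ y′) i
lookup-++-pointwise _∼_ x x′ y y′ x∼x′ y∼y′ =
  Pointwise.lookup (Pointwise.++⁺ (toPointwise x x′ x∼x′) (toPointwise y y′ y∼y′))
  where
  toPointwise : ∀ {n} (a : Vec _ n) (b : Vec _ n) → (∀ i → lookup a i ∼ lookup b i) →
                Pointwise.Pointwise _∼_ a b
  toPointwise a b a∼b = extensional⇒inductive (ext a∼b)

lookup-++-all : ∀ {A : Set} (P : A → Set) {r s} (x : Vec A r) (y : Vec A s) →
                (∀ i → P (lookup x i)) → (∀ j → P (lookup y j)) → ∀ i → P (lookup (x ++ y) i)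
lookup-++-all P x y Px Py =
  All.lookup⁺ (All.++⁺ (All.lookup⁻ {P = P} {xs = x} Px) (All.lookup⁻ {P = P} {xs = y} Py))

theorem3p13 : (r s : ℕ) → 1 ≤ s → (u : Vec ℕ r) → ((i : Fin r) → 1 ≤ lookup u i)
    → (w ℓ : Vec ℕ s) → ((i : Fin s) → 2 ≤ lookup ℓ i) → ((i : Fin s) → lookup ℓ i ≤ lookup w i)
    → (R : Subset s) → IsRepresentatives w ℓ R
    → (n : ℕ)
    → IsC (u ++ w) (ones r ++ ℓ) 2 n ⇔ IsC (u ++ restrict w R) (ones r ++ restrict ℓ R) 2 n
theorem3p13 r (suc s) _ u 1≤u w ℓ 2≤ℓ ℓ≤w R (rep-exists , rep-unique) =
  IsC-collapse {v = u ++ w} {ones r ++ ℓ} {u ++ restrict w R} {ones r ++ restrict ℓ R}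
    (lift r repIndex) (lift r (unrank R)) (lift-inverse r repIndex-unrank)
    (lookup-++-lift u (restrict-invariant w proj₁)) (lookup-++-lift (ones r) (restrict-invariant ℓ proj₂))
    merged⇒2≤k 1≤k k≤v (r ↑ʳ zero) (2≤k zero)
  where
  open Transversal R (Equiv w ℓ) rep-exists rep-unique

  restrict-invariant : ∀ (y : Vec ℕ (suc s)) → (∀ {i j} → Equiv w ℓ i j → lookup y i ≡ lookup y j) →
                       ∀ j → lookup y j ≡ lookup (restrict y R) (repIndex j)
  restrict-invariant y respects j =
    trans (respects (∼-unrank-repIndex j)) (sym (lookup-restrict y R (repIndex j)))

  2≤k : ∀ j → 2 ≤ lookup (ones r ++ ℓ) (r ↑ʳ j)
  2≤k j = subst (2 ≤_) (sym (lookup-++ʳ (ones r) ℓ j)) (2≤ℓ j)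

  merged⇒2≤k : ∀ i i′ → i ≢ i′ → lift r repIndex i ≡ lift r repIndex i′ → 2 ≤ lookup (ones r ++ ℓ) i
  merged⇒2≤k i i′ i≢i′ merged with j , refl ← lift-merged⇒↑ʳ r repIndex i≢i′ merged = 2≤k j

  1≤k : ∀ i → 1 ≤ lookup (ones r ++ ℓ) i
  1≤k = lookup-++-all (1 ≤_) (ones r) ℓ (λ i → ℕ.≤-reflexive (sym (lookup-ones r i)))
                                        (λ j → ℕ.≤-trans (s≤s z≤n) (2≤ℓ j))

  k≤v : ∀ i → lookup (ones r ++ ℓ) i ≤ lookup (u ++ w) i
  k≤v = lookup-++-pointwise _≤_ (ones r) u ℓ w
          (λ i → subst (_≤ lookup u i) (sym (lookup-ones r i)) (1≤u i)) ℓ≤w
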